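{- There exists a tournament $T$ on $13$ vertices having a minimum feedback arc set $S$ such that the digraph induced by $S$ is acyclic and has a hamiltonian path, and such that $\nu(T)=11$ and $\tau(T)=12$. In particular, $\nu(T)\neq\tau(T)$, so the answer to Isaak's question (whether every tournament having a minimum feedback arc set which induces an acyclic digraph with a hamiltonian path satisfies $\tau(T)=\nu(T)$) is negative.
   Context: For a digraph $D=(V,A)$, a set $S\subseteq A$ is a feedback arc set if $D-S$ is acyclic; $\tau(D)$ is the minimum cardinality of a feedback arc set of $D$, and a minimum feedback arc set is one of cardinality $\tau(D)$. $\nu(D)$ is the maximum number of pairwise arc-disjoint (directed) cycles in $D$. The digraph induced by an arc set $S$ is the digraph whose arcs are those of $S$ and whose vertices are the endpoints of arcs of $S$; it has a hamiltonian path if some directed path in it passes through each of its vertices exactly once. -}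

module Defs where

open import Data.Nat using (ℕ; _≤_)
open import Data.Fin using (Fin)
open import Data.Bool using (Bool; true; false; _∧_; not; if_then_else_)
open import Data.List using (List; []; _∷_; _++_; zip; drop; map; allFin; length)
open import Data.Nat.ListAction using (sum)
open import Data.List.Membership.Propositional using (_∈_)
open import Data.List.Relation.Unary.All using (All)
open import Data.List.Relation.Unary.Unique.Propositional using (Unique)
open import Data.List.Relation.Unary.AllPairs using (AllPairs)
open import Data.List.Relation.Binary.Disjoint.Propositional using (Disjoint)
open import Data.Product using (Σ; _×_; _,_; ∃)
open import Data.Sum using (_⊎_)
open import Relation.Binary.PropositionalEquality using (_≡_; _≢_)
open import Relation.Nullary using (¬_)
open import Function.Bundles using (_⇔_)

Digraph : ℕ → Set
Digraph n = Fin n → Fin n → Bool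

ArcSet : ℕ → Set
ArcSet = Digraph

module _ {n : ℕ} where

  Arc : Digraph n → Fin n → Fin n → Set
  Arc D u v = D u v ≡ true

  IsTournament : Digraph n → Set
  IsTournament T = (∀ u → T u u ≡ false) × (∀ u v → u ≢ v → T u v ≡ not (T v u))

  _⊆A_ : ArcSet n → Digraph n → Set
  S ⊆A D = ∀ u v → Arc S u v → Arc D u v

  size : ArcSet n → ℕ
  size S = sum (map (λ u → sum (map (λ v → if S u v then 1 else 0) (allFin n))) (allFin n))

  _─_ : Digraph n → ArcSet n → Digraph n
  (D ─ S) u v = D u v ∧ not (S u v)

  cycleArcs : List (Fin n) → List (Fin n × Fin n)
  cycleArcs [] = []
  cycleArcs (v ∷ vs) = zip (v ∷ vs) (vs ++ (v ∷ []))

  pathArcs : List (Fin n) → List (Fin n × Fin n)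
  pathArcs vs = zip vs (drop 1 vs)

  ArcP : Digraph n → Fin n × Fin n → Set
  ArcP D (u , v) = Arc D u v

  IsCycle : Digraph n → List (Fin n) → Set
  IsCycle D c = (c ≢ []) × Unique c × All (ArcP D) (cycleArcs c)

  Acyclic : Digraph n → Set
  Acyclic D = ∀ c → ¬ IsCycle D c

  IsFAS : Digraph n → ArcSet n → Set
  IsFAS D S = S ⊆A D × Acyclic (D ─ S)

  IsMinFAS : Digraph n → ArcSet n → Set
  IsMinFAS D S = IsFAS D S × (∀ S' → IsFAS D S' → size S ≤ size S')

  TauIs : Digraph n → ℕ → Set
  TauIs D k = (Σ (ArcSet n) λ S → IsFAS D S × size S ≡ k)
            × (∀ S → IsFAS D S → k ≤ size S)

  ArcDisjointCycles : Digraph n → ℕ → Set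
  ArcDisjointCycles D k = Σ (List (List (Fin n))) λ cs →
    (length cs ≡ k) × All (IsCycle D) cs
    × AllPairs (λ c c' → Disjoint (cycleArcs c) (cycleArcs c')) cs

  NuIs : Digraph n → ℕ → Set
  NuIs D k = ArcDisjointCycles D k × (∀ m → ArcDisjointCycles D m → m ≤ k)

  -- Vertices of the digraph induced by the arc set S: endpoints of arcs of S.
  IsEndpoint : ArcSet n → Fin n → Set
  IsEndpoint S v = ∃ λ u → Arc S v u ⊎ Arc S u v

  HasHamPath : ArcSet n → Set
  HasHamPath S = Σ (List (Fin n)) λ p →
    Unique p × All (ArcP S) (pathArcs p) × (∀ v → (v ∈ p) ⇔ IsEndpoint S v)

-- T is the transitive tournament on 0, …, 12 with the twelve arcs of S reversed. Every arc
-- of S goes backwards and every other arc of T forwards, so S is an acyclic feedback arc set,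
-- and the path 11 → 8 → 6 → 4 → 2 → 0 runs through all endpoints of S. Eleven arc-disjoint
-- triangles give ν ≥ 11 and S itself gives τ ≤ 12.
--
-- The matching bounds come from a fractional optimum of value 23/2, which integrality rounds
-- down for ν and up for τ. On one side, 23 triangles of T use every arc at most twice; a
-- feedback arc set meets each of them, so 2τ ≥ 23. On the other, arc weights in {0, ½, 1}
-- of total 23/2 give every cycle weight at least 1, so 2ν ≤ 23. The cycle weights are
-- certified by potentials: the weighted distances π v from each vertex v, capped at 1, satisfy
-- π v y ≤ π v x + w(x, y) on every arc, and w(u, v) + π v u ≥ 1 + π v v on every arc uv,
-- so any cycle through uv weighs at least 1.

module Submission where

open import Defs
open import Algebra.Properties.CommutativeSemigroup using (interchange)
open import Data.Bool using (Bool; true; false; not; _∧_; if_then_else_)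
open import Data.Bool.Properties using (¬-not; not-involutive; ∧-inverseʳ) renaming (_≟_ to _≟ᵇ_)
open import Data.Fin using (Fin; zero; suc; toℕ; _<_; #_)
open import Data.Fin.Properties
  using (_≟_; _<?_; <-trans; <-irrefl; <-asym; <-cmp; all?; any?) renaming (≤-antisym to ≤ᶠ-antisym)
open import Data.List using (List; []; _∷_; _++_; zip; map; concatMap; tabulate; allFin; length)
open import Data.List.Properties using (map-tabulate; map-++)
import Data.List.Properties as List
open import Data.List.Membership.Propositional using (_∈_; _∉_)
open import Data.List.Relation.Unary.All using (All; []; _∷_)
import Data.List.Relation.Unary.All as All
import Data.List.Relation.Unary.All.Properties as All
open import Data.List.Relation.Unary.All.Properties using (¬Any⇒All¬)
open import Data.List.Relation.Unary.AllPairs using ([]; _∷_; allPairs?)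
import Data.List.Relation.Unary.AllPairs.Properties as AllPairs
open import Data.List.Relation.Unary.Any using (Any; here; there)
import Data.List.Relation.Unary.Any as Any
open import Data.List.Relation.Unary.Unique.Propositional using (Unique)
open import Data.List.Relation.Unary.Unique.Propositional.Properties
  using (Unique[x∷xs]⇒x∉xs) renaming (concat⁺ to unique-concat⁺)
import Data.List.Relation.Unary.Unique.DecPropositional as UniqueDec
open import Data.Nat using (ℕ; zero; suc; _+_; _*_; _≤_; z≤n; s≤s)
open import Data.Nat.ListAction using (sum)
open import Data.Nat.ListAction.Properties using (sum-++)
open import Data.Nat.Properties
  using ( +-assoc; +-comm; +-identityʳ; +-commutativeSemigroup; +-mono-≤; +-monoˡ-≤; +-monoʳ-≤; +-cancelʳ-≤
        ; *-assoc; *-identityˡ; *-identityʳ; *-zeroʳ; *-distribˡ-+; *-distribʳ-+; *-monoˡ-≤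
        ; *-cancelˡ-<; *-cancelʳ-<; ≤-reflexive; ≤-trans; ≤-pred; m≤n+m; ≮⇒≥; _≤?_; module ≤-Reasoning)
open import Data.Product using (Σ; _×_; _,_; proj₁; proj₂; uncurry)
open import Data.Product.Properties using (≡-dec)
open import Data.Sum using (inj₁; inj₂)
open import Data.Vec using (Vec; []; _∷_)
import Data.Vec as Vec
open import Function using (_∘_; id; flip)
open import Function.Bundles using (mk⇔)
open import Relation.Binary using (Rel; Transitive; Irreflexive; tri<; tri≈; tri>)
open import Relation.Binary.PropositionalEquality
  using (_≡_; _≢_; refl; sym; trans; cong; cong₂; module ≡-Reasoning)
open import Relation.Nullary using (¬_; ¬?; Dec; yes; no; does; contradiction; _×-dec_; _⊎-dec_; _→-dec_)
open import Relation.Nullary.Decidable using (from-yes)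

open import Data.List.Membership.DecPropositional (_≟_ {13}) using (_∈?_)
open import Data.List.Relation.Binary.Disjoint.DecPropositional (≡-dec (_≟_ {13}) (_≟_ {13})) using (disjoint?)

private
  variable
    n k : ℕ

-- Sums over Fin n

𝟙 : Bool → ℕ
𝟙 b = if b then 1 else 0

∑ : (Fin n → ℕ) → ℕ
∑ f = sum (tabulate f)

∑-cong : {f g : Fin n → ℕ} → (∀ i → f i ≡ g i) → ∑ f ≡ ∑ g
∑-cong {n = zero}  _   = refl
∑-cong {n = suc n} f≗g = cong₂ _+_ (f≗g zero) (∑-cong (f≗g ∘ suc))

∑-mono-≤ : {f g : Fin n → ℕ} → (∀ i → f i ≤ g i) → ∑ f ≤ ∑ g
∑-mono-≤ {n = zero}  _   = z≤n
∑-mono-≤ {n = suc n} f≤g = +-mono-≤ (f≤g zero) (∑-mono-≤ (f≤g ∘ suc))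

∑-zero : ∀ n → ∑ {n} (λ _ → 0) ≡ 0
∑-zero zero    = refl
∑-zero (suc n) = ∑-zero n

∑-distrib-+ : (f g : Fin n → ℕ) → ∑ (λ i → f i + g i) ≡ ∑ f + ∑ g
∑-distrib-+ {n = zero}  f g = refl
∑-distrib-+ {n = suc n} f g = begin
  f zero + g zero + ∑ (λ i → f (suc i) + g (suc i))
    ≡⟨ cong (f zero + g zero +_) (∑-distrib-+ (f ∘ suc) (g ∘ suc)) ⟩
  f zero + g zero + (∑ (f ∘ suc) + ∑ (g ∘ suc))
    ≡⟨ interchange +-commutativeSemigroup (f zero) (g zero) (∑ (f ∘ suc)) (∑ (g ∘ suc)) ⟩
  f zero + ∑ (f ∘ suc) + (g zero + ∑ (g ∘ suc))
    ∎
  where open ≡-Reasoning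

*-distribˡ-∑ : ∀ k (f : Fin n → ℕ) → k * ∑ f ≡ ∑ (λ i → k * f i)
*-distribˡ-∑ {n = zero}  k f = *-zeroʳ k
*-distribˡ-∑ {n = suc n} k f =
  trans (*-distribˡ-+ k (f zero) (∑ (f ∘ suc))) (cong (k * f zero +_) (*-distribˡ-∑ k (f ∘ suc)))

δ : Fin n → Fin n → ℕ
δ i j = 𝟙 (does (i ≟ j))

∑-δ : (f : Fin n → ℕ) → ∀ j → ∑ (λ i → δ i j * f i) ≡ f j
∑-δ {n = suc n} f zero    =
  trans (cong₂ _+_ (+-identityʳ (f zero)) (∑-zero n)) (+-identityʳ (f zero))
∑-δ {n = suc n} f (suc j) = ∑-δ (f ∘ suc) j

∑₂ : (Fin n → Fin n → ℕ) → ℕ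
∑₂ f = ∑ λ u → ∑ λ v → f u v

∑₂-zero : ∀ n → ∑₂ {n} (λ _ _ → 0) ≡ 0
∑₂-zero n = trans (∑-cong {n = n} λ _ → ∑-zero n) (∑-zero n)

∑₂-mono-≤ : {f g : Fin n → Fin n → ℕ} → (∀ u v → f u v ≤ g u v) → ∑₂ f ≤ ∑₂ g
∑₂-mono-≤ f≤g = ∑-mono-≤ λ u → ∑-mono-≤ (f≤g u)

∑₂-cong : {f g : Fin n → Fin n → ℕ} → (∀ u v → f u v ≡ g u v) → ∑₂ f ≡ ∑₂ g
∑₂-cong f≗g = ∑-cong λ u → ∑-cong (f≗g u)

∑₂-distrib-+ : (f g : Fin n → Fin n → ℕ) → ∑₂ (λ u v → f u v + g u v) ≡ ∑₂ f + ∑₂ g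
∑₂-distrib-+ f g =
  trans (∑-cong λ u → ∑-distrib-+ (f u) (g u)) (∑-distrib-+ (λ u → ∑ (f u)) (λ u → ∑ (g u)))

*-distribˡ-∑₂ : ∀ k (f : Fin n → Fin n → ℕ) → k * ∑₂ f ≡ ∑₂ (λ u v → k * f u v)
*-distribˡ-∑₂ k f = trans (*-distribˡ-∑ k (λ u → ∑ (f u))) (∑-cong λ u → *-distribˡ-∑ k (f u))

∑₂-δ : (f : Fin n → Fin n → ℕ) → ∀ x y → ∑₂ (λ u v → δ u x * δ v y * f u v) ≡ f x y
∑₂-δ f x y = begin
  ∑₂ (λ u v → δ u x * δ v y * f u v)
    ≡⟨ ∑₂-cong (λ u v → *-assoc (δ u x) (δ v y) (f u v)) ⟩
  ∑ (λ u → ∑ λ v → δ u x * (δ v y * f u v))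
    ≡⟨ ∑-cong (λ u → *-distribˡ-∑ (δ u x) (λ v → δ v y * f u v)) ⟨
  ∑ (λ u → δ u x * ∑ λ v → δ v y * f u v)
    ≡⟨ ∑-cong (λ u → cong (δ u x *_) (∑-δ (f u) y)) ⟩
  ∑ (λ u → δ u x * f u y)
    ≡⟨ ∑-δ (λ u → f u y) x ⟩
  f x y
    ∎
  where open ≡-Reasoning

size≡∑₂ : (S : ArcSet n) → size S ≡ ∑₂ λ u v → 𝟙 (S u v)
size≡∑₂ {n} S =
  trans (cong sum (map-tabulate id row)) (∑-cong λ u → cong sum (map-tabulate id (λ v → 𝟙 (S u v))))
  where
  row : Fin n → ℕ
  row u = sum (map (λ v → 𝟙 (S u v)) (allFin n))

-- Counting arcs with multiplicity

δ-refl : (i : Fin n) → δ i i ≡ 1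
δ-refl i with i ≟ i
... | yes _   = refl
... | no i≢i = contradiction refl i≢i

δ-≢ : {i j : Fin n} → i ≢ j → δ i j ≡ 0
δ-≢ {i = i} {j} i≢j with i ≟ j
... | yes i≡j = contradiction i≡j i≢j
... | no _    = refl

δ₂ : Fin n × Fin n → Fin n × Fin n → ℕ
δ₂ (u , v) (x , y) = δ u x * δ v y

δ₂-refl : (a : Fin n × Fin n) → δ₂ a a ≡ 1
δ₂-refl (u , v) = cong₂ _*_ (δ-refl u) (δ-refl v)

δ₂-≢ : {a b : Fin n × Fin n} → a ≢ b → δ₂ a b ≡ 0
δ₂-≢ {a = u , v} {x , y} a≢b with u ≟ x
... | no _     = refl
... | yes refl = trans (+-identityʳ (δ v y)) (δ-≢ λ v≡y → a≢b (cong (u ,_) v≡y))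

multiplicity : Fin n × Fin n → List (Fin n × Fin n) → ℕ
multiplicity a = sum ∘ map (δ₂ a)

multiplicity-∉ : {a : Fin n × Fin n} (as : List (Fin n × Fin n)) → a ∉ as → multiplicity a as ≡ 0
multiplicity-∉ []       _   = refl
multiplicity-∉ (b ∷ as) a∉ = cong₂ _+_ (δ₂-≢ (a∉ ∘ here)) (multiplicity-∉ as (a∉ ∘ there))

multiplicity-unique : (a : Fin n × Fin n) {as : List (Fin n × Fin n)} → Unique as → multiplicity a as ≤ 1
multiplicity-unique a {[]}     _ = z≤n
multiplicity-unique a {b ∷ as} b∷as!@(_ ∷ as!) with ≡-dec _≟_ _≟_ a b
... | yes refl = ≤-reflexive (cong₂ _+_ (δ₂-refl a) (multiplicity-∉ as (Unique[x∷xs]⇒x∉xs b∷as!)))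
... | no a≢b   =
  ≤-trans (≤-reflexive (cong (_+ multiplicity a as) (δ₂-≢ a≢b))) (multiplicity-unique a as!)

arcSum : (Fin n → Fin n → ℕ) → List (Fin n × Fin n) → ℕ
arcSum w = sum ∘ map (uncurry w)

arcSum-double-count : (w : Fin n → Fin n → ℕ) (as : List (Fin n × Fin n)) →
                      arcSum w as ≡ ∑₂ λ u v → multiplicity (u , v) as * w u v
arcSum-double-count {n} w []         = sym (∑₂-zero n)
arcSum-double-count     w ((x , y) ∷ as) = begin
  w x y + arcSum w as
    ≡⟨ cong₂ _+_ (∑₂-δ w x y) (sym (arcSum-double-count w as)) ⟨
  ∑₂ (λ u v → δ u x * δ v y * w u v) + ∑₂ (λ u v → multiplicity (u , v) as * w u v)
    ≡⟨ ∑₂-distrib-+ (λ u v → δ u x * δ v y * w u v) (λ u v → multiplicity (u , v) as * w u v) ⟨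
  ∑₂ (λ u v → δ u x * δ v y * w u v + multiplicity (u , v) as * w u v)
    ≡⟨ ∑₂-cong (λ u v → *-distribʳ-+ (w u v) (δ u x * δ v y) (multiplicity (u , v) as)) ⟨
  ∑₂ (λ u v → multiplicity (u , v) ((x , y) ∷ as) * w u v)
    ∎
  where open ≡-Reasoning

arcSum-++ : (w : Fin n → Fin n → ℕ) (as bs : List (Fin n × Fin n)) →
            arcSum w (as ++ bs) ≡ arcSum w as + arcSum w bs
arcSum-++ w as bs = trans (cong sum (map-++ (uncurry w) as bs)) (sum-++ (map (uncurry w) as) (map (uncurry w) bs))

arcSum-concatMap : {A : Set} (w : Fin n → Fin n → ℕ) (f : A → List (Fin n × Fin n)) (xs : List A) →
                   arcSum w (concatMap f xs) ≡ sum (map (arcSum w ∘ f) xs)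
arcSum-concatMap w f []       = refl
arcSum-concatMap w f (x ∷ xs) =
  trans (arcSum-++ w (f x) (concatMap f xs)) (cong (arcSum w (f x) +_) (arcSum-concatMap w f xs))

length-*-≤-sum : {A : Set} (g : A → ℕ) {xs : List A} →
                 All (λ x → k ≤ g x) xs → length xs * k ≤ sum (map g xs)
length-*-≤-sum g []           = z≤n
length-*-≤-sum g (k≤gx ∷ k≤g) = +-mono-≤ k≤gx (length-*-≤-sum g k≤g)

-- Cycles, paths and feedback arc sets

walkArcs : Fin n → List (Fin n) → Fin n → List (Fin n × Fin n)
walkArcs x xs y = zip (x ∷ xs) (xs ++ y ∷ [])

module _ {ℓ} {D : Digraph n} {_≺_ : Rel (Fin n) ℓ}
         (≺-trans : Transitive _≺_) (arc⇒≺ : ∀ {u v} → Arc D u v → u ≺ v) where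

  walk-≺ : ∀ x xs y → All (ArcP D) (walkArcs x xs y) → x ≺ y
  walk-≺ x []       y (xy ∷ [])   = arc⇒≺ xy
  walk-≺ x (z ∷ zs) y (xz ∷ arcs) = ≺-trans (arc⇒≺ xz) (walk-≺ z zs y arcs)

  acyclic-if-arcs-≺ : Irreflexive _≡_ _≺_ → Acyclic D
  acyclic-if-arcs-≺ ≺-irrefl []       (c≢[] , _)     = c≢[] refl
  acyclic-if-arcs-≺ ≺-irrefl (v ∷ vs) (_ , _ , arcs) = ≺-irrefl refl (walk-≺ v vs v arcs)

zip-unique : {A B : Set} {xs : List A} (ys : List B) → Unique xs → Unique (zip xs ys)
zip-unique {xs = []}     _        _             = []
zip-unique {xs = _ ∷ _}  []       _             = []
zip-unique {xs = x ∷ xs} (y ∷ ys) (x∉xs ∷ xs!) = fresh xs ys x∉xs ∷ zip-unique ys xs!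
  where
  fresh : ∀ xs ys → All (x ≢_) xs → All ((x , y) ≢_) (zip xs ys)
  fresh []       _        _           = []
  fresh (_ ∷ _)  []       _           = []
  fresh (_ ∷ xs) (_ ∷ ys) (x≢ ∷ x≢s) = (x≢ ∘ cong proj₁) ∷ fresh xs ys x≢s

cycleArcs-unique : {c : List (Fin n)} → Unique c → Unique (cycleArcs c)
cycleArcs-unique {c = []}     _  = []
cycleArcs-unique {c = v ∷ vs} c! = zip-unique (vs ++ v ∷ []) c!

arc? : (D : Digraph n) (u v : Fin n) → Dec (Arc D u v)
arc? D u v = D u v ≟ᵇ true

isCycle? : (D : Digraph n) (c : List (Fin n)) → Dec (IsCycle D c)
isCycle? D c = ¬? (List.≡-dec _≟_ c [])
          ×-dec UniqueDec.unique? _≟_ c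
          ×-dec All.all? (λ (u , v) → arc? D u v) (cycleArcs c)

arc-─ : {D S : Digraph n} {u v : Fin n} → Arc D u v → ¬ Arc S u v → Arc (D ─ S) u v
arc-─ d ¬s = cong₂ _∧_ d (cong not (¬-not ¬s))

fas-meets-cycle : {D : Digraph n} {S : ArcSet n} {c : List (Fin n)} →
                  IsFAS D S → IsCycle D c → Any (ArcP S) (cycleArcs c)
fas-meets-cycle {D = D} {S} {c} (_ , acyclic) (c≢[] , c! , arcs)
  with Any.any? (λ (u , v) → arc? S u v) (cycleArcs c)
... | yes hit  = hit
... | no  miss = contradiction (c≢[] , c! , arcs-in-D─S) (acyclic c)
  where
  arcs-in-D─S : All (ArcP (D ─ S)) (cycleArcs c)
  arcs-in-D─S = All.zipWith (λ { {_ , _} (d , ¬s) → arc-─ {D = D} {S} d ¬s }) (arcs , ¬Any⇒All¬ _ miss)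

arcSum-𝟙-≥1 : {S : ArcSet n} {as : List (Fin n × Fin n)} →
              Any (ArcP S) as → 1 ≤ arcSum (λ u v → 𝟙 (S u v)) as
arcSum-𝟙-≥1 {as = _ ∷ _} (here s)    rewrite s = s≤s z≤n
arcSum-𝟙-≥1 {as = _ ∷ _} (there hit) = ≤-trans (arcSum-𝟙-≥1 hit) (m≤n+m _ _)

endpoint-of-path : {S : ArcSet n} {x y v : Fin n} (zs : List (Fin n)) →
                   All (ArcP S) (pathArcs (x ∷ y ∷ zs)) → v ∈ x ∷ y ∷ zs → IsEndpoint S v
endpoint-of-path _        (xy ∷ _)    (here refl)         = _ , inj₁ xy
endpoint-of-path []       (xy ∷ _)    (there (here refl)) = _ , inj₂ xy
endpoint-of-path (_ ∷ zs) (_ ∷ arcs) (there v∈)          = endpoint-of-path zs arcs v∈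

-- Fractional certificates for τ and ν

packing-≤-fas-size : {D : Digraph n} {S : ArcSet n} (cs : List (List (Fin n))) → All (IsCycle D) cs →
                     (∀ u v → multiplicity (u , v) (concatMap cycleArcs cs) ≤ k) →
                     IsFAS D S → length cs ≤ k * size S
packing-≤-fas-size {k = k} {S = S} cs cycles load fas = begin
  length cs
    ≡⟨ *-identityʳ (length cs) ⟨
  length cs * 1
    ≤⟨ length-*-≤-sum (hits ∘ cycleArcs) (All.map (arcSum-𝟙-≥1 ∘ fas-meets-cycle fas) cycles) ⟩
  sum (map (hits ∘ cycleArcs) cs)
    ≡⟨ arcSum-concatMap 𝟙S cycleArcs cs ⟨
  hits arcs
    ≡⟨ arcSum-double-count 𝟙S arcs ⟩
  ∑₂ (λ u v → multiplicity (u , v) arcs * 𝟙S u v)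
    ≤⟨ ∑₂-mono-≤ (λ u v → *-monoˡ-≤ (𝟙S u v) (load u v)) ⟩
  ∑₂ (λ u v → k * 𝟙S u v)
    ≡⟨ *-distribˡ-∑₂ k 𝟙S ⟨
  k * ∑₂ 𝟙S
    ≡⟨ cong (k *_) (size≡∑₂ S) ⟨
  k * size S
    ∎
  where
  open ≤-Reasoning
  𝟙S : Fin _ → Fin _ → ℕ
  𝟙S u v = 𝟙 (S u v)
  hits : List (Fin _ × Fin _) → ℕ
  hits = arcSum 𝟙S
  arcs : List (Fin _ × Fin _)
  arcs = concatMap cycleArcs cs

disjoint-cycles-≤-weight : {D : Digraph n} {m : ℕ} (w : Fin n → Fin n → ℕ) →
                           (∀ {c} → IsCycle D c → k ≤ arcSum w (cycleArcs c)) →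
                           ArcDisjointCycles D m → m * k ≤ ∑₂ w
disjoint-cycles-≤-weight {k = k} w heavy (cs , refl , cycles , disjoint) = begin
  length cs * k
    ≤⟨ length-*-≤-sum (arcSum w ∘ cycleArcs) (All.map heavy cycles) ⟩
  sum (map (arcSum w ∘ cycleArcs) cs)
    ≡⟨ arcSum-concatMap w cycleArcs cs ⟨
  arcSum w arcs
    ≡⟨ arcSum-double-count w arcs ⟩
  ∑₂ (λ u v → multiplicity (u , v) arcs * w u v)
    ≤⟨ ∑₂-mono-≤ (λ u v → *-monoˡ-≤ (w u v) (multiplicity-unique (u , v) arcs!)) ⟩
  ∑₂ (λ u v → 1 * w u v)
    ≡⟨ ∑₂-cong (λ u v → *-identityˡ (w u v)) ⟩
  ∑₂ w
    ∎
  where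
  open ≤-Reasoning
  arcs : List (Fin _ × Fin _)
  arcs = concatMap cycleArcs cs
  arcs! : Unique arcs
  arcs! = unique-concat⁺ (All.map⁺ (All.map (cycleArcs-unique ∘ proj₁ ∘ proj₂) cycles))
                         (AllPairs.map⁺ disjoint)

module _ {D : Digraph n} (w : Fin n → Fin n → ℕ) (π : Fin n → Fin n → ℕ)
         (feasible : ∀ v x y → Arc D x y → π v y ≤ π v x + w x y)
         (tight : ∀ u v → Arc D u v → k + π v v ≤ w u v + π v u) where

  walk-potential : ∀ v x xs y → All (ArcP D) (walkArcs x xs y) →
                   π v y ≤ π v x + arcSum w (walkArcs x xs y)
  walk-potential v x []       y (xy ∷ [])   =
    ≤-trans (feasible v x y xy) (≤-reflexive (cong (π v x +_) (sym (+-identityʳ (w x y)))))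
  walk-potential v x (z ∷ zs) y (xz ∷ arcs) = begin
    π v y                                       ≤⟨ walk-potential v z zs y arcs ⟩
    π v z + arcSum w (walkArcs z zs y)          ≤⟨ +-monoˡ-≤ _ (feasible v x z xz) ⟩
    π v x + w x z + arcSum w (walkArcs z zs y)  ≡⟨ +-assoc (π v x) (w x z) _ ⟩
    π v x + (w x z + arcSum w (walkArcs z zs y)) ∎
    where open ≤-Reasoning

  cycle-weight-≥ : ∀ {c} → IsCycle D c → k ≤ arcSum w (cycleArcs c)
  cycle-weight-≥ {[]}         (c≢[] , _)           = contradiction refl c≢[]
  cycle-weight-≥ {u ∷ []}     (_ , _ , uu ∷ [])    =
    +-cancelʳ-≤ (π u u) k (w u u + 0)
      (≤-trans (tight u u uu) (≤-reflexive (cong (_+ π u u) (sym (+-identityʳ (w u u))))))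
  cycle-weight-≥ {u ∷ v ∷ vs} (_ , _ , uv ∷ arcs) = +-cancelʳ-≤ (π v v) k (w u v + rest) (begin
    k + π v v                  ≤⟨ tight u v uv ⟩
    w u v + π v u              ≤⟨ +-monoʳ-≤ (w u v) (walk-potential v v vs u arcs) ⟩
    w u v + (π v v + rest)     ≡⟨ cong (w u v +_) (+-comm (π v v) rest) ⟩
    w u v + (rest + π v v)     ≡⟨ +-assoc (w u v) rest (π v v) ⟨
    w u v + rest + π v v       ∎)
    where
    open ≤-Reasoning
    rest : ℕ
    rest = arcSum w (walkArcs v vs u)

-- Reversing arcs of a transitive tournament

Backward : ArcSet n → Set
Backward S = ∀ u v → Arc S u v → v < u

reversal : ArcSet n → Digraph n
reversal S u v with <-cmp u v
... | tri< _ _ _ = not (S v u)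
... | tri≈ _ _ _ = S u v
... | tri> _ _ _ = S u v

module _ (S : ArcSet n) {u v : Fin n} where

  reversal-< : u < v → reversal S u v ≡ not (S v u)
  reversal-< u<v with <-cmp u v
  ... | tri< _   _ _ = refl
  ... | tri≈ u≮v _ _ = contradiction u<v u≮v
  ... | tri> u≮v _ _ = contradiction u<v u≮v

  reversal-≮ : ¬ u < v → reversal S u v ≡ S u v
  reversal-≮ u≮v with <-cmp u v
  ... | tri< u<v _ _ = contradiction u<v u≮v
  ... | tri≈ _   _ _ = refl
  ... | tri> _   _ _ = refl

module _ {S : ArcSet n} (backward : Backward S) where

  ⊆-reversal : S ⊆A reversal S
  ⊆-reversal u v s = trans (reversal-≮ S (<-asym (backward u v s))) s

  reversal-isTournament : IsTournament (reversal S)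
  reversal-isTournament = loopless , antisymmetric
    where
    loopless : ∀ u → reversal S u u ≡ false
    loopless u = trans (reversal-≮ S (<-irrefl refl)) (¬-not λ s → <-irrefl refl (backward u u s))

    antisymmetric : ∀ u v → u ≢ v → reversal S u v ≡ not (reversal S v u)
    antisymmetric u v u≢v with u <? v | v <? u
    ... | yes u<v | yes v<u = contradiction v<u (<-asym u<v)
    ... | yes u<v | no  v≮u = trans (reversal-< S u<v) (cong not (sym (reversal-≮ S v≮u)))
    ... | no  u≮v | yes v<u = begin
      reversal S u v          ≡⟨ reversal-≮ S u≮v ⟩
      S u v                   ≡⟨ not-involutive (S u v) ⟨
      not (not (S u v))       ≡⟨ cong not (reversal-< S v<u) ⟨
      not (reversal S v u)    ∎
      where open ≡-Reasoning
    ... | no  u≮v | no  v≮u = contradiction (≤ᶠ-antisym (≮⇒≥ v≮u) (≮⇒≥ u≮v)) u≢v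

  reversal-isFAS : IsFAS (reversal S) S
  reversal-isFAS = ⊆-reversal , acyclic-if-arcs-≺ <-trans forward <-irrefl
    where
    forward : ∀ {u v} → Arc (reversal S ─ S) u v → u < v
    forward {u} {v} arc with u <? v
    ... | yes u<v = u<v
    ... | no  u≮v = contradiction (trans (sym (∧-inverseʳ (S u v))) x∧not-x) λ ()
      where
      x∧not-x : S u v ∧ not (S u v) ≡ true
      x∧not-x = trans (cong (_∧ not (S u v)) (sym (reversal-≮ S u≮v))) arc

  backward-acyclic : Acyclic S
  backward-acyclic = acyclic-if-arcs-≺ (flip <-trans) (λ {u} {v} → backward u v) (<-irrefl ∘ sym)

-- The tournament on 13 vertices

S₁₃ : ArcSet 13
S₁₃ u v = backArc (toℕ u) (toℕ v)
  where
  backArc : ℕ → ℕ → Bool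
  backArc 2  0 = true
  backArc 4  2 = true
  backArc 6  0 = true
  backArc 6  4 = true
  backArc 8  0 = true
  backArc 8  2 = true
  backArc 8  6 = true
  backArc 11 0 = true
  backArc 11 2 = true
  backArc 11 4 = true
  backArc 11 6 = true
  backArc 11 8 = true
  backArc _  _ = false

T₁₃ : Digraph 13
T₁₃ = reversal S₁₃

S₁₃-backward : Backward S₁₃
S₁₃-backward = from-yes (all? λ u → all? λ v → arc? S₁₃ u v →-dec v <? u)

S₁₃-hamiltonian : HasHamPath S₁₃
S₁₃-hamiltonian = path , from-yes (UniqueDec.unique? _≟_ path) , arcs
                , λ v → mk⇔ (endpoint-of-path _ arcs) (covers v)
  where
  path : List (Fin 13)
  path = # 11 ∷ # 8 ∷ # 6 ∷ # 4 ∷ # 2 ∷ # 0 ∷ []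
  arcs : All (ArcP S₁₃) (pathArcs path)
  arcs = from-yes (All.all? (λ (u , v) → arc? S₁₃ u v) (pathArcs path))
  covers : ∀ v → IsEndpoint S₁₃ v → v ∈ path
  covers = from-yes (all? λ v → any? (λ u → arc? S₁₃ v u ⊎-dec arc? S₁₃ u v) →-dec v ∈? path)

halfPacking : List (List (Fin 13))
halfPacking =
  (# 0 ∷ # 1 ∷ # 2 ∷ [])  ∷ (# 0 ∷ # 1 ∷ # 2 ∷ [])  ∷ (# 0 ∷ # 3 ∷ # 6 ∷ [])  ∷ (# 0 ∷ # 3 ∷ # 11 ∷ []) ∷
  (# 0 ∷ # 4 ∷ # 8 ∷ [])  ∷ (# 0 ∷ # 4 ∷ # 8 ∷ [])  ∷ (# 0 ∷ # 5 ∷ # 6 ∷ [])  ∷ (# 0 ∷ # 5 ∷ # 11 ∷ []) ∷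
  (# 2 ∷ # 3 ∷ # 4 ∷ [])  ∷ (# 2 ∷ # 3 ∷ # 11 ∷ []) ∷ (# 2 ∷ # 5 ∷ # 8 ∷ [])  ∷ (# 2 ∷ # 5 ∷ # 8 ∷ [])  ∷
  (# 2 ∷ # 6 ∷ # 4 ∷ [])  ∷ (# 2 ∷ # 7 ∷ # 11 ∷ []) ∷ (# 4 ∷ # 5 ∷ # 6 ∷ [])  ∷ (# 4 ∷ # 5 ∷ # 11 ∷ []) ∷
  (# 4 ∷ # 7 ∷ # 11 ∷ []) ∷ (# 6 ∷ # 7 ∷ # 8 ∷ [])  ∷ (# 6 ∷ # 7 ∷ # 8 ∷ [])  ∷ (# 6 ∷ # 10 ∷ # 11 ∷ []) ∷
  (# 6 ∷ # 10 ∷ # 11 ∷ []) ∷ (# 8 ∷ # 9 ∷ # 11 ∷ []) ∷ (# 8 ∷ # 9 ∷ # 11 ∷ []) ∷ []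

τ₁₃≥12 : ∀ S → IsFAS T₁₃ S → 12 ≤ size S
τ₁₃≥12 S fas = *-cancelˡ-< 2 11 (size S) packing-bound
  where
  cycles : All (IsCycle T₁₃) halfPacking
  cycles = from-yes (All.all? (isCycle? T₁₃) halfPacking)
  load : ∀ u v → multiplicity (u , v) (concatMap cycleArcs halfPacking) ≤ 2
  load = from-yes (all? λ u → all? λ v → multiplicity (u , v) (concatMap cycleArcs halfPacking) ≤? 2)
  packing-bound : 23 ≤ 2 * size S
  packing-bound = packing-≤-fas-size halfPacking cycles load fas

elevenDisjointTriangles : ArcDisjointCycles T₁₃ 11
elevenDisjointTriangles = triangles , refl
                        , from-yes (All.all? (isCycle? T₁₃) triangles)
                        , from-yes (allPairs? (λ c c′ → disjoint? (cycleArcs c) (cycleArcs c′)) triangles)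
  where
  triangles : List (List (Fin 13))
  triangles =
    (# 0 ∷ # 1 ∷ # 2 ∷ [])  ∷ (# 0 ∷ # 3 ∷ # 6 ∷ [])  ∷ (# 0 ∷ # 4 ∷ # 8 ∷ [])  ∷ (# 0 ∷ # 5 ∷ # 11 ∷ []) ∷
    (# 2 ∷ # 3 ∷ # 4 ∷ [])  ∷ (# 2 ∷ # 5 ∷ # 8 ∷ [])  ∷ (# 2 ∷ # 7 ∷ # 11 ∷ []) ∷ (# 4 ∷ # 5 ∷ # 6 ∷ [])  ∷
    (# 4 ∷ # 9 ∷ # 11 ∷ []) ∷ (# 6 ∷ # 7 ∷ # 8 ∷ [])  ∷ (# 6 ∷ # 10 ∷ # 11 ∷ []) ∷ []

-- Arc weights in units of ½.
halfWeight : Fin 13 → Fin 13 → ℕ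
halfWeight u v = weight (toℕ u) (toℕ v)
  where
  weight : ℕ → ℕ → ℕ
  weight 0  1  = 2
  weight 0  3  = 1
  weight 0  4  = 1
  weight 0  5  = 1
  weight 2  3  = 1
  weight 2  5  = 1
  weight 3  11 = 1
  weight 4  2  = 1
  weight 4  5  = 1
  weight 5  11 = 1
  weight 6  0  = 1
  weight 6  4  = 1
  weight 7  8  = 1
  weight 7  11 = 2
  weight 8  0  = 1
  weight 8  2  = 1
  weight 8  6  = 1
  weight 9  11 = 2
  weight 10 11 = 2
  weight _  _  = 0

-- distance v x is the halfWeight-distance in T₁₃ from v to x, capped at 2.
distance : Fin 13 → Fin 13 → ℕ
distance v x = Vec.lookup (Vec.lookup table v) x
  where
  table : Vec (Vec ℕ 13) 13
  table =
    (0 ∷ 2 ∷ 2 ∷ 1 ∷ 1 ∷ 1 ∷ 1 ∷ 0 ∷ 1 ∷ 0 ∷ 0 ∷ 2 ∷ 0 ∷ []) ∷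
    (0 ∷ 0 ∷ 0 ∷ 0 ∷ 0 ∷ 0 ∷ 0 ∷ 0 ∷ 0 ∷ 0 ∷ 0 ∷ 0 ∷ 0 ∷ []) ∷
    (0 ∷ 2 ∷ 0 ∷ 1 ∷ 1 ∷ 1 ∷ 0 ∷ 0 ∷ 1 ∷ 0 ∷ 0 ∷ 2 ∷ 0 ∷ []) ∷
    (1 ∷ 2 ∷ 1 ∷ 0 ∷ 0 ∷ 0 ∷ 0 ∷ 0 ∷ 0 ∷ 0 ∷ 0 ∷ 1 ∷ 0 ∷ []) ∷
    (1 ∷ 2 ∷ 1 ∷ 2 ∷ 0 ∷ 1 ∷ 1 ∷ 0 ∷ 0 ∷ 0 ∷ 0 ∷ 2 ∷ 0 ∷ []) ∷
    (1 ∷ 2 ∷ 1 ∷ 2 ∷ 1 ∷ 0 ∷ 0 ∷ 0 ∷ 0 ∷ 0 ∷ 0 ∷ 1 ∷ 0 ∷ []) ∷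
    (1 ∷ 2 ∷ 2 ∷ 2 ∷ 1 ∷ 2 ∷ 0 ∷ 0 ∷ 1 ∷ 0 ∷ 0 ∷ 2 ∷ 0 ∷ []) ∷
    (2 ∷ 2 ∷ 2 ∷ 2 ∷ 2 ∷ 2 ∷ 2 ∷ 0 ∷ 1 ∷ 0 ∷ 0 ∷ 2 ∷ 0 ∷ []) ∷
    (1 ∷ 2 ∷ 1 ∷ 2 ∷ 2 ∷ 2 ∷ 1 ∷ 1 ∷ 0 ∷ 0 ∷ 0 ∷ 2 ∷ 0 ∷ []) ∷
    (2 ∷ 2 ∷ 2 ∷ 2 ∷ 2 ∷ 2 ∷ 2 ∷ 2 ∷ 2 ∷ 0 ∷ 0 ∷ 2 ∷ 0 ∷ []) ∷
    (2 ∷ 2 ∷ 2 ∷ 2 ∷ 2 ∷ 2 ∷ 2 ∷ 2 ∷ 2 ∷ 2 ∷ 0 ∷ 2 ∷ 0 ∷ []) ∷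
    (0 ∷ 2 ∷ 0 ∷ 1 ∷ 0 ∷ 1 ∷ 0 ∷ 0 ∷ 0 ∷ 0 ∷ 0 ∷ 0 ∷ 0 ∷ []) ∷
    (2 ∷ 2 ∷ 2 ∷ 2 ∷ 2 ∷ 2 ∷ 2 ∷ 2 ∷ 2 ∷ 2 ∷ 2 ∷ 2 ∷ 0 ∷ []) ∷ []

ν₁₃≤11 : ∀ m → ArcDisjointCycles T₁₃ m → m ≤ 11
ν₁₃≤11 m cs = ≤-pred (*-cancelʳ-< 2 m 12 (s≤s weight-bound))
  where
  feasible : ∀ v x y → Arc T₁₃ x y → distance v y ≤ distance v x + halfWeight x y
  feasible = from-yes (all? λ v → all? λ x → all? λ y →
                         arc? T₁₃ x y →-dec distance v y ≤? distance v x + halfWeight x y)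
  tight : ∀ u v → Arc T₁₃ u v → 2 + distance v v ≤ halfWeight u v + distance v u
  tight = from-yes (all? λ u → all? λ v →
                      arc? T₁₃ u v →-dec 2 + distance v v ≤? halfWeight u v + distance v u)
  weight-bound : m * 2 ≤ 23
  weight-bound = disjoint-cycles-≤-weight halfWeight (cycle-weight-≥ halfWeight distance feasible tight) cs

mainTheorem1 : Σ (Digraph 13) λ T → IsTournament T
    × Σ (ArcSet 13) (λ S → IsMinFAS T S × Acyclic S × HasHamPath S)
    × NuIs T 11 × TauIs T 12
mainTheorem1 = T₁₃ , reversal-isTournament S₁₃-backward
             , ( S₁₃ , (reversal-isFAS S₁₃-backward , τ₁₃≥12)
               , backward-acyclic S₁₃-backward , S₁₃-hamiltonian )
             , (elevenDisjointTriangles , ν₁₃≤11)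
             , ((S₁₃ , reversal-isFAS S₁₃-backward , refl) , τ₁₃≥12)
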